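{- For all integers $N\ge 0$ and $n\ge 1$, $$E_{N,2n}=(2n)!\sum_{r=1}^n(-1)^r\sum_{\substack{i_1+\cdots+i_r=n\\ i_1,\dots,i_r\ge 1}}\frac{\bigl((2N)!\bigr)^r}{(2N+2i_1)!\cdots(2N+2i_r)!}.$$
   Context: For an integer $N\ge 0$, the hypergeometric Euler numbers $E_{N,n}$ ($n\ge 0$) are defined by $\dfrac{1}{F_N(t)}=\sum_{n=0}^\infty E_{N,n}\frac{t^n}{n!}$, where $F_N(t)={}_1F_2\bigl(1;N+1,\tfrac{2N+1}{2};\tfrac{t^2}{4}\bigr)=\sum_{m\ge 0}\frac{(2N)!}{(2N+2m)!}t^{2m}$ (equivalently $\sum_n E_{N,n}t^n/n!=\frac{t^{2N}/(2N)!}{\cosh t-\sum_{m=0}^{N-1}t^{2m}/(2m)!}$). The inner sum runs over ordered $r$-tuples of positive integers summing to $n$. -}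

module Defs where

open import Data.Nat as ℕ using (ℕ; zero; suc; _!; _∸_)
open import Data.Nat.Properties using (_!≢0)
open import Data.Integer using (+_)
open import Data.Rational using (ℚ; _/_; 0ℚ; 1ℚ; _+_; _*_; -_)
open import Data.List using (List; []; _∷_; map; concat; foldr; zipWith; upTo)

sumℚ : List ℚ → ℚ
sumℚ = foldr _+_ 0ℚ

prodℚ : List ℚ → ℚ
prodℚ = foldr _*_ 1ℚ

_!/_! : ℕ → ℕ → ℚ
a !/ b ! = (+ (a !)) / (b !)
  where instance _ = b !≢0

-- Coefficient of t^k in F_N(t) = Σ_{m≥0} (2N)!/(2N+2m)! t^{2m}
-- (coefficient of odd powers is 0)
Fcoeff : ℕ → ℕ → ℚ
Fcoeff N k with k ℕ.% 2
... | zero  = (2 ℕ.* N) !/ (2 ℕ.* N ℕ.+ k) !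
... | suc _ = 0ℚ

-- Coefficients of the reciprocal power series 1/F_N(t) = Σ b_k t^k.
-- Since F_N has constant term 1: b_0 = 1 and
-- b_k = - Σ_{j=1}^{k} [t^j]F_N · b_{k-j}  for k ≥ 1.
-- recipRev N k = [ b_k , b_{k-1} , … , b_0 ]
recipRev : ℕ → ℕ → List ℚ
recipRev N zero = 1ℚ ∷ []
recipRev N (suc k) =
  (- sumℚ (zipWith _*_ (map (λ j → Fcoeff N (suc j)) (upTo (suc k))) prev)) ∷ prev
  where prev = recipRev N k

head0 : List ℚ → ℚ
head0 []      = 0ℚ
head0 (x ∷ _) = x

recipCoeff : ℕ → ℕ → ℚ
recipCoeff N k = head0 (recipRev N k)

-- Hypergeometric Euler numbers: 1/F_N(t) = Σ E_{N,n} t^n / n!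
E : ℕ → ℕ → ℚ
E N n = (+ (n !) / 1) * recipCoeff N n

compositions : ℕ → ℕ → List (List ℕ)
compositions zero zero    = [] ∷ []
compositions zero (suc n) = []
compositions (suc r) n =
  concat (map (λ j → map (suc j ∷_) (compositions r (n ∸ suc j))) (upTo n))

sgn : ℕ → ℚ
sgn zero    = 1ℚ
sgn (suc r) = - sgn r

rhsSum : ℕ → ℕ → ℚ
rhsSum N n =
  sumℚ (map (λ r → sgn (suc r) *
              sumℚ (map (λ c → prodℚ (map (λ i → (2 ℕ.* N) !/ (2 ℕ.* N ℕ.+ 2 ℕ.* i) !) c))
                        (compositions (suc r) n)))
            (upTo n))

{-# OPTIONS --safe #-}
module Submission where

-- Write F_N(t) = 1 + Σ_{i≥1} gᵢ t²ⁱ with gᵢ = (2N)!/(2N+2i)!. Formally 1/F_N = Σᵣ (−Σᵢ gᵢ t²ⁱ)ʳ, and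
-- the coefficient of t²ⁿ on the right is the composition sum of the theorem. Instead of power
-- series we use recurrences: the coefficients of 1/(1 + Σ_{k≥1} fₖ tᵏ) are determined by
-- x₀ = 1, x_{m+1} = −Σ_{j≤m} f_{j+1} x_{m−j}. Since F_N is even, the even coefficients of 1/F_N
-- satisfy this recurrence for (gᵢ), and splitting off the first part of each composition shows
-- that the composition sums satisfy it too.

open import Defs
open import Data.Nat using (ℕ; _≤_; _!)
open import Data.Nat as ℕ using (zero; suc; _∸_; _<_; s≤s)
import Data.Nat.Properties as ℕₚ
open import Data.Nat.DivMod using ([m+kn]%n≡m%n; m*n%n≡0)
open import Data.Fin using (toℕ)
open import Data.Integer using (+_)
open import Data.Rational using (ℚ; 0ℚ; 1ℚ; _+_; -_; _/_; _*_)
open import Data.Rational.Properties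
open import Data.List using (List; []; _∷_; map; concat; zipWith; applyUpTo; upTo; _++_)
open import Data.List.Properties using (map-∘; map-upTo)
open import Data.Vec.Functional using (Vector; head; tail)
open import Function using (_∘_)
open import Algebra.Bundles using (CommutativeRing)
open import Algebra.Properties.Semiring.Sum (CommutativeRing.semiring +-*-commutativeRing)
open import Algebra.Properties.CommutativeSemigroup (CommutativeRing.*-commutativeSemigroup +-*-commutativeRing)
  using (x∙yz≈y∙xz)
open import Relation.Binary.PropositionalEquality
open ≡-Reasoning

sumℚ-map-++ : ∀ {A : Set} (P : A → ℚ) xs ys → sumℚ (map P (xs ++ ys)) ≡ sumℚ (map P xs) + sumℚ (map P ys)
sumℚ-map-++ P []       ys = sym (+-identityˡ _)
sumℚ-map-++ P (x ∷ xs) ys = trans (cong (_+_ (P x)) (sumℚ-map-++ P xs ys)) (sym (+-assoc (P x) _ _))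

sumℚ-map-concat : ∀ {A : Set} (P : A → ℚ) xss → sumℚ (map P (concat xss)) ≡ sumℚ (map (sumℚ ∘ map P) xss)
sumℚ-map-concat P []         = refl
sumℚ-map-concat P (xs ∷ xss) =
  trans (sumℚ-map-++ P xs (concat xss)) (cong (_+_ (sumℚ (map P xs))) (sumℚ-map-concat P xss))

zipWith-applyUpTo : ∀ {A B C : Set} (_∙_ : A → B → C) (g : ℕ → A) (h : ℕ → B) n →
  zipWith _∙_ (applyUpTo g n) (applyUpTo h n) ≡ applyUpTo (λ i → g i ∙ h i) n
zipWith-applyUpTo _∙_ g h zero    = refl
zipWith-applyUpTo _∙_ g h (suc n) = cong (g 0 ∙ h 0 ∷_) (zipWith-applyUpTo _∙_ (g ∘ suc) (h ∘ suc) n)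

sumℚ-applyUpTo : ∀ (h : ℕ → ℚ) n → sumℚ (applyUpTo h n) ≡ ∑[ i < n ] h (toℕ i)
sumℚ-applyUpTo h zero    = refl
sumℚ-applyUpTo h (suc n) = cong (_+_ (h 0)) (sumℚ-applyUpTo (h ∘ suc) n)

neg-sum : ∀ {n} (f : Vector ℚ n) → - sum f ≡ ∑[ i < n ] (- f i)
neg-sum {zero}  f = refl
neg-sum {suc n} f = trans (neg-distrib-+ (head f) (sum (tail f))) (cong (_+_ (- head f)) (neg-sum (tail f)))

sum-pairs : ∀ (h : ℕ → ℚ) m →
  ∑[ j < m ℕ.* 2 ] h (toℕ j) ≡ ∑[ i < m ] (h (toℕ i ℕ.* 2) + h (suc (toℕ i ℕ.* 2)))
sum-pairs h zero    = refl
sum-pairs h (suc m) =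
  trans (sym (+-assoc (h 0) (h 1) _)) (cong (_+_ (h 0 + h 1)) (sum-pairs (h ∘ suc ∘ suc) m))

sum-vanishing-tail : ∀ (h : ℕ → ℚ) a b → (∀ i → h (a ℕ.+ i) ≡ 0ℚ) →
  ∑[ i < a ℕ.+ b ] h (toℕ i) ≡ ∑[ i < a ] h (toℕ i)
sum-vanishing-tail h zero    b h≡0 = trans (sum-cong-≗ {b} {h ∘ toℕ} (h≡0 ∘ toℕ)) (sum-replicate-zero b)
sum-vanishing-tail h (suc a) b h≡0 = cong (_+_ (h 0)) (sum-vanishing-tail (h ∘ suc) a b h≡0)

-- f 0 is ignored: the series being inverted is 1 + Σ_{k≥1} fₖ tᵏ.
record IsReciprocalOf (f x : ℕ → ℚ) : Set where
  constructor isReciprocal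
  field
    zeroth     : x 0 ≡ 1ℚ
    recurrence : ∀ m → x (suc m) ≡ - ∑[ j < suc m ] (f (suc (toℕ j)) * x (m ∸ toℕ j))

IsReciprocalOf-cong : ∀ {f g x} → (∀ k → f k ≡ g k) → IsReciprocalOf f x → IsReciprocalOf g x
IsReciprocalOf-cong {x = x} f≗g (isReciprocal x₀ x-rec) = isReciprocal x₀ λ m →
  trans (x-rec m) (cong -_ (sum-cong-≗ {suc m} λ j → cong (_* x (m ∸ toℕ j)) (f≗g (suc (toℕ j)))))

reciprocal-unique : ∀ {f x y} → IsReciprocalOf f x → IsReciprocalOf f y → ∀ m → x m ≡ y m
reciprocal-unique {f} {x} {y} (isReciprocal x₀ x-rec) (isReciprocal y₀ y-rec) m = bounded m m ℕₚ.≤-refl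
  where
  bounded : ∀ L m → m ≤ L → x m ≡ y m
  bounded _       zero    _         = trans x₀ (sym y₀)
  bounded (suc L) (suc m) (s≤s m≤L) = begin
    x (suc m)                                          ≡⟨ x-rec m ⟩
    - ∑[ j < suc m ] (f (suc (toℕ j)) * x (m ∸ toℕ j))  ≡⟨ cong -_ (sum-cong-≗ {suc m} λ j →
                                                            cong (_*_ (f (suc (toℕ j)))) (earlier (toℕ j))) ⟩
    - ∑[ j < suc m ] (f (suc (toℕ j)) * y (m ∸ toℕ j))  ≡⟨ y-rec m ⟨
    y (suc m)                                          ∎
    where
    earlier : ∀ j → x (m ∸ j) ≡ y (m ∸ j)
    earlier j = bounded L (m ∸ j) (ℕₚ.≤-trans (ℕₚ.m∸n≤m m j) m≤L)

evenPart-isReciprocal : ∀ {f x} → (∀ k → f (suc (k ℕ.* 2)) ≡ 0ℚ) → IsReciprocalOf f x →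
  IsReciprocalOf (λ k → f (k ℕ.* 2)) (λ k → x (k ℕ.* 2))
evenPart-isReciprocal {f} {x} f-odd≡0 (isReciprocal x₀ x-rec) = isReciprocal x₀ λ m → begin
  x (suc m ℕ.* 2)                                                      ≡⟨ x-rec (suc (m ℕ.* 2)) ⟩
  - ∑[ j < suc m ℕ.* 2 ] term m (toℕ j)                                 ≡⟨ cong -_ (sum-pairs (term m) (suc m)) ⟩
  - ∑[ i < suc m ] (term m (toℕ i ℕ.* 2) + term m (suc (toℕ i ℕ.* 2)))  ≡⟨ cong -_ (sum-cong-≗ {suc m} (term-pair m ∘ toℕ)) ⟩
  - ∑[ i < suc m ] (f (suc (toℕ i) ℕ.* 2) * x ((m ∸ toℕ i) ℕ.* 2))      ∎
  where
  term : ℕ → ℕ → ℚ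
  term m j = f (suc j) * x (suc (m ℕ.* 2) ∸ j)
  term-pair : ∀ m i → term m (i ℕ.* 2) + term m (suc (i ℕ.* 2)) ≡ f (suc i ℕ.* 2) * x ((m ∸ i) ℕ.* 2)
  term-pair m i = begin
    term m (i ℕ.* 2) + term m (suc (i ℕ.* 2))  ≡⟨ cong (_+ term m (suc (i ℕ.* 2))) (trans
                                                     (cong (_* x (suc (m ℕ.* 2) ∸ i ℕ.* 2)) (f-odd≡0 i))
                                                     (*-zeroˡ (x (suc (m ℕ.* 2) ∸ i ℕ.* 2)))) ⟩
    0ℚ + term m (suc (i ℕ.* 2))                 ≡⟨ +-identityˡ _ ⟩
    f (suc i ℕ.* 2) * x (m ℕ.* 2 ∸ i ℕ.* 2)     ≡⟨ cong (λ k → f (suc i ℕ.* 2) * x k) (ℕₚ.*-distribʳ-∸ 2 m i) ⟨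
    f (suc i ℕ.* 2) * x ((m ∸ i) ℕ.* 2)         ∎

weight : (ℕ → ℚ) → List ℕ → ℚ
weight a c = prodℚ (map a c)

sumℚ-weight-∷ : ∀ a i cs → sumℚ (map (weight a) (map (i ∷_) cs)) ≡ a i * sumℚ (map (weight a) cs)
sumℚ-weight-∷ a i []       = sym (*-zeroʳ (a i))
sumℚ-weight-∷ a i (c ∷ cs) =
  trans (cong (_+_ (a i * weight a c)) (sumℚ-weight-∷ a i cs)) (sym (*-distribˡ-+ (a i) (weight a c) _))

compositionSum : (ℕ → ℚ) → ℕ → ℕ → ℚ
compositionSum a r k = sumℚ (map (weight a) (compositions r k))

compositionSum-suc : ∀ a r k →
  compositionSum a (suc r) k ≡ ∑[ j < k ] (a (suc (toℕ j)) * compositionSum a r (k ∸ suc (toℕ j)))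
compositionSum-suc a r k = begin
  sumℚ (map (weight a) (concat (map prefixed (upTo k))))
    ≡⟨ sumℚ-map-concat (weight a) (map prefixed (upTo k)) ⟩
  sumℚ (map (sumℚ ∘ map (weight a)) (map prefixed (upTo k)))
    ≡⟨ cong sumℚ (trans (sym (map-∘ (upTo k))) (map-upTo _ k)) ⟩
  sumℚ (applyUpTo (sumℚ ∘ map (weight a) ∘ prefixed) k)
    ≡⟨ sumℚ-applyUpTo _ k ⟩
  ∑[ j < k ] sumℚ (map (weight a) (prefixed (toℕ j)))
    ≡⟨ sum-cong-≗ {k} (λ j → sumℚ-weight-∷ a (suc (toℕ j)) (compositions r (k ∸ suc (toℕ j)))) ⟩
  ∑[ j < k ] (a (suc (toℕ j)) * compositionSum a r (k ∸ suc (toℕ j))) ∎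
  where
  prefixed : ℕ → List (List ℕ)
  prefixed j = map (suc j ∷_) (compositions r (k ∸ suc j))

compositionSum-vanishes : ∀ a {r k} → k < r → compositionSum a r k ≡ 0ℚ
compositionSum-vanishes a {suc r} {zero}  _         = refl
compositionSum-vanishes a {suc r} {suc k} (s≤s k<r) = begin
  compositionSum a (suc r) (suc k)                                   ≡⟨ compositionSum-suc a r (suc k) ⟩
  ∑[ j < suc k ] (a (suc (toℕ j)) * compositionSum a r (k ∸ toℕ j))  ≡⟨ sum-cong-≗ {suc k} (term≡0 ∘ toℕ) ⟩
  ∑[ j < suc k ] 0ℚ                                                  ≡⟨ sum-replicate-zero (suc k) ⟩
  0ℚ                                                                 ∎
  where
  term≡0 : ∀ j → a (suc j) * compositionSum a r (k ∸ j) ≡ 0ℚ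
  term≡0 j = trans (cong (_*_ (a (suc j))) (compositionSum-vanishes a (ℕₚ.≤-trans (s≤s (ℕₚ.m∸n≤m k j)) k<r)))
                   (*-zeroʳ (a (suc j)))

signedCompositionSum : (ℕ → ℚ) → ℕ → ℕ → ℚ
signedCompositionSum a r k = sgn r * compositionSum a r k

signedCompositionSum-suc : ∀ a r m → signedCompositionSum a (suc r) (suc m) ≡
  - ∑[ j < suc m ] (a (suc (toℕ j)) * signedCompositionSum a r (m ∸ toℕ j))
signedCompositionSum-suc a r m = begin
  - sgn r * compositionSum a (suc r) (suc m)
    ≡⟨ cong (_*_ (- sgn r)) (compositionSum-suc a r (suc m)) ⟩
  - sgn r * ∑[ j < suc m ] (a (suc (toℕ j)) * compositionSum a r (m ∸ toℕ j))
    ≡⟨ neg-distribˡ-* (sgn r) _ ⟨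
  - (sgn r * ∑[ j < suc m ] (a (suc (toℕ j)) * compositionSum a r (m ∸ toℕ j)))
    ≡⟨ cong -_ (*-distribˡ-sum {suc m} (sgn r) (λ j → a (suc (toℕ j)) * compositionSum a r (m ∸ toℕ j))) ⟩
  - ∑[ j < suc m ] (sgn r * (a (suc (toℕ j)) * compositionSum a r (m ∸ toℕ j)))
    ≡⟨ cong -_ (sum-cong-≗ {suc m} λ j → x∙yz≈y∙xz (sgn r) (a (suc (toℕ j))) (compositionSum a r (m ∸ toℕ j))) ⟩
  - ∑[ j < suc m ] (a (suc (toℕ j)) * signedCompositionSum a r (m ∸ toℕ j)) ∎

-- The coefficient of tᵏ in Σᵣ (−Σ_{i≥1} aᵢ tⁱ)ʳ; only r ≤ k contributes.
compositionExpansion : (ℕ → ℚ) → ℕ → ℚ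
compositionExpansion a k = ∑[ r < suc k ] signedCompositionSum a (toℕ r) k

compositionExpansion-suc : ∀ a m →
  compositionExpansion a (suc m) ≡ ∑[ r < suc m ] signedCompositionSum a (suc (toℕ r)) (suc m)
-- The r = 0 term is 0: a positive integer has no composition into zero parts.
compositionExpansion-suc a m = +-identityˡ _

compositionExpansion-extend : ∀ a {k L} → k ≤ L →
  ∑[ r < suc L ] signedCompositionSum a (toℕ r) k ≡ compositionExpansion a k
compositionExpansion-extend a {k} {L} k≤L = begin
  ∑[ r < suc L ] signedCompositionSum a (toℕ r) k
    ≡⟨ cong (λ n → ∑[ r < suc n ] signedCompositionSum a (toℕ r) k) (ℕₚ.m+[n∸m]≡n k≤L) ⟨
  ∑[ r < suc k ℕ.+ (L ∸ k) ] signedCompositionSum a (toℕ r) k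
    ≡⟨ sum-vanishing-tail (λ r → signedCompositionSum a r k) (suc k) (L ∸ k) (λ i →
         trans (cong (_*_ (sgn (suc k ℕ.+ i))) (compositionSum-vanishes a (s≤s (ℕₚ.m≤m+n k i))))
               (*-zeroʳ (sgn (suc k ℕ.+ i)))) ⟩
  compositionExpansion a k ∎

compositionExpansion-isReciprocal : ∀ a → IsReciprocalOf a (compositionExpansion a)
compositionExpansion-isReciprocal a = isReciprocal refl recurrence
  where
  recurrence : ∀ m → compositionExpansion a (suc m) ≡
    - ∑[ j < suc m ] (a (suc (toℕ j)) * compositionExpansion a (m ∸ toℕ j))
  recurrence m = begin
    compositionExpansion a (suc m)
      ≡⟨ compositionExpansion-suc a m ⟩
    ∑[ r < suc m ] signedCompositionSum a (suc (toℕ r)) (suc m)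
      ≡⟨ sum-cong-≗ {suc m} (λ r → signedCompositionSum-suc a (toℕ r) m) ⟩
    ∑[ r < suc m ] (- ∑[ j < suc m ] term (toℕ r) (toℕ j))
      ≡⟨ neg-sum {suc m} (λ r → ∑[ j < suc m ] term (toℕ r) (toℕ j)) ⟨
    - ∑[ r < suc m ] ∑[ j < suc m ] term (toℕ r) (toℕ j)
      ≡⟨ cong -_ (∑-comm {suc m} {suc m} (λ r j → term (toℕ r) (toℕ j))) ⟩
    - ∑[ j < suc m ] ∑[ r < suc m ] term (toℕ r) (toℕ j)
      ≡⟨ cong -_ (sum-cong-≗ {suc m} λ j → *-distribˡ-sum {suc m} (a (suc (toℕ j)))
           (λ r → signedCompositionSum a (toℕ r) (m ∸ toℕ j))) ⟨
    - ∑[ j < suc m ] (a (suc (toℕ j)) * ∑[ r < suc m ] signedCompositionSum a (toℕ r) (m ∸ toℕ j))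
      ≡⟨ cong -_ (sum-cong-≗ {suc m} λ j → cong (_*_ (a (suc (toℕ j))))
           (compositionExpansion-extend a (ℕₚ.m∸n≤m m (toℕ j)))) ⟩
    - ∑[ j < suc m ] (a (suc (toℕ j)) * compositionExpansion a (m ∸ toℕ j)) ∎
    where
    term : ℕ → ℕ → ℚ
    term r j = a (suc j) * signedCompositionSum a r (m ∸ j)

recipRev-applyUpTo : ∀ N k → recipRev N k ≡ applyUpTo (λ i → recipCoeff N (k ∸ i)) (suc k)
recipRev-applyUpTo N zero    = refl
recipRev-applyUpTo N (suc k) = cong (recipCoeff N (suc k) ∷_) (recipRev-applyUpTo N k)

recipCoeff-isReciprocal : ∀ N → IsReciprocalOf (Fcoeff N) (recipCoeff N)
recipCoeff-isReciprocal N = isReciprocal refl λ k → cong -_ (begin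
  sumℚ (zipWith _*_ (map (Fcoeff N ∘ suc) (upTo (suc k))) (recipRev N k))
    ≡⟨ cong₂ (λ u v → sumℚ (zipWith _*_ u v)) (map-upTo (Fcoeff N ∘ suc) (suc k)) (recipRev-applyUpTo N k) ⟩
  sumℚ (zipWith _*_ (applyUpTo (Fcoeff N ∘ suc) (suc k)) (applyUpTo (λ i → recipCoeff N (k ∸ i)) (suc k)))
    ≡⟨ cong sumℚ (zipWith-applyUpTo _*_ (Fcoeff N ∘ suc) (λ i → recipCoeff N (k ∸ i)) (suc k)) ⟩
  sumℚ (applyUpTo (λ j → Fcoeff N (suc j) * recipCoeff N (k ∸ j)) (suc k))
    ≡⟨ sumℚ-applyUpTo (λ j → Fcoeff N (suc j) * recipCoeff N (k ∸ j)) (suc k) ⟩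
  ∑[ j < suc k ] (Fcoeff N (suc (toℕ j)) * recipCoeff N (k ∸ toℕ j)) ∎)

Fcoeff-odd : ∀ N k → Fcoeff N (suc (k ℕ.* 2)) ≡ 0ℚ
Fcoeff-odd N k rewrite [m+kn]%n≡m%n 1 k 2 ⦃ _ ⦄ = refl

evenFcoeff : ℕ → ℕ → ℚ
evenFcoeff N i = (2 ℕ.* N) !/ (2 ℕ.* N ℕ.+ 2 ℕ.* i) !

Fcoeff-even : ∀ N k → Fcoeff N (k ℕ.* 2) ≡ evenFcoeff N k
Fcoeff-even N k rewrite m*n%n≡0 k 2 ⦃ _ ⦄ | ℕₚ.*-comm k 2 = refl

rhsSum≡compositionExpansion : ∀ N m → rhsSum N (suc m) ≡ compositionExpansion (evenFcoeff N) (suc m)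
rhsSum≡compositionExpansion N m = begin
  rhsSum N (suc m)
    ≡⟨ cong sumℚ (map-upTo term (suc m)) ⟩
  sumℚ (applyUpTo term (suc m))
    ≡⟨ sumℚ-applyUpTo term (suc m) ⟩
  ∑[ r < suc m ] term (toℕ r)
    ≡⟨ compositionExpansion-suc (evenFcoeff N) m ⟨
  compositionExpansion (evenFcoeff N) (suc m) ∎
  where
  term : ℕ → ℚ
  term r = signedCompositionSum (evenFcoeff N) (suc r) (suc m)

theorem1 : (N n : ℕ) → 1 ≤ n →
    E N (2 ℕ.* n) ≡ ((+ ((2 ℕ.* n) !)) / 1) * rhsSum N n
theorem1 N (suc m) _ = cong (_*_ (+ ((2 ℕ.* suc m) !) / 1)) (begin
  recipCoeff N (2 ℕ.* suc m)                  ≡⟨ cong (recipCoeff N) (ℕₚ.*-comm 2 (suc m)) ⟩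
  recipCoeff N (suc m ℕ.* 2)                  ≡⟨ evenCoeff≡expansion (suc m) ⟩
  compositionExpansion (evenFcoeff N) (suc m) ≡⟨ rhsSum≡compositionExpansion N m ⟨
  rhsSum N (suc m)                            ∎)
  where
  evenCoeff≡expansion : ∀ k → recipCoeff N (k ℕ.* 2) ≡ compositionExpansion (evenFcoeff N) k
  evenCoeff≡expansion = reciprocal-unique
    (IsReciprocalOf-cong (Fcoeff-even N) (evenPart-isReciprocal (Fcoeff-odd N) (recipCoeff-isReciprocal N)))
    (compositionExpansion-isReciprocal (evenFcoeff N))
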